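{- Let $\mathcal{M}$ be a $q$-matroid on $\mathbb{F}_q^n$ of rank $k$ with $0<k<n$. Then there is no nonzero vector $x\in\mathbb{F}_q^n$ that belongs to every basis of $\mathcal{M}$.
   Context: A $q$-matroid is a pair $(\mathbb{F}_q^n,\rho)$ where $\rho$ maps $\mathbb{F}_q$-subspaces to nonnegative integers with $0\le\rho(X)\le\dim X$, $\rho(X)\le\rho(Y)$ for $X\subseteq Y$, and $\rho(X+Y)+\rho(X\cap Y)\le\rho(X)+\rho(Y)$. Its rank is $\rho(\mathbb{F}_q^n)$. A subspace $X$ is independent if $\rho(X)=\dim X$; a basis is an independent subspace not strictly contained in any independent subspace. -}

module Defs where

open import Data.Nat using (ℕ; _≤_)
open import Data.Bool using (Bool; T)
open import Data.List using (List; []; _∷_; length)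
open import Data.List.Relation.Unary.All using (All)
import Data.List.Membership.Propositional as LMem
open import Data.Vec using (Vec; replicate; zipWith; map)
open import Data.Product using (Σ; _×_; ∃)
open import Relation.Nullary using (¬_; Dec)
open import Relation.Binary.PropositionalEquality using (_≡_)
open import Algebra.Structures using (IsCommutativeRing)

-- A finite field (every finite field is some F_q, and every F_q is one),
-- with propositional equality on its carrier.
record FiniteField : Set₁ where
  field
    F     : Set
    _+_   : F → F → F
    _*_   : F → F → F
    -_    : F → F
    0#    : F
    1#    : F
    isCommutativeRing : IsCommutativeRing _≡_ _+_ _*_ -_ 0# 1#
    0≢1   : ¬ (0# ≡ 1#)
    inv   : ∀ a → ¬ (a ≡ 0#) → Σ F λ b → a * b ≡ 1#
    _≟_   : (a b : F) → Dec (a ≡ b)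
    elements : List F
    complete : ∀ a → a LMem.∈ elements

module _ (K : FiniteField) where
  open FiniteField K

  V : ℕ → Set
  V n = Vec F n

  zeroV : ∀ {n} → V n
  zeroV = replicate _ 0#

  _⊕_ : ∀ {n} → V n → V n → V n
  u ⊕ v = zipWith _+_ u v

  _·_ : ∀ {n} → F → V n → V n
  c · v = map (c *_) v

  record Subspace (n : ℕ) : Set where
    field
      mem     : V n → Bool
      zero∈   : T (mem zeroV)
      ⊕-closed : ∀ u v → T (mem u) → T (mem v) → T (mem (u ⊕ v))
      ·-closed : ∀ c v → T (mem v) → T (mem (c · v))
  open Subspace public

  _∈S_ : ∀ {n} → V n → Subspace n → Set
  v ∈S X = T (mem X v)

  _⊆S_ : ∀ {n} → Subspace n → Subspace n → Set
  X ⊆S Y = ∀ v → v ∈S X → v ∈S Y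

  -- linear combination  Σ cᵢ vᵢ  (lists of equal length; extra entries dropped)
  lincomb : ∀ {n} → List F → List (V n) → V n
  lincomb (c ∷ cs) (v ∷ vs) = (c · v) ⊕ lincomb cs vs
  lincomb _ _ = zeroV

  LinIndep : ∀ {n} → List (V n) → Set
  LinIndep vs = ∀ cs → length cs ≡ length vs → lincomb cs vs ≡ zeroV → All (_≡ 0#) cs

  IsBasisList : ∀ {n} → Subspace n → List (V n) → Set
  IsBasisList X vs = All (_∈S X) vs × LinIndep vs × (∀ v → v ∈S X → Σ (List F) λ cs → lincomb cs vs ≡ v)

  HasDim : ∀ {n} → Subspace n → ℕ → Set
  HasDim X d = Σ _ λ vs → IsBasisList X vs × length vs ≡ d

  fullSpace : (n : ℕ) → Subspace n
  fullSpace n = record { mem = λ _ → Data.Bool.true ; zero∈ = _ ; ⊕-closed = λ _ _ _ _ → _ ; ·-closed = λ _ _ _ → _ }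

  _∈Sum_,_ : ∀ {n} → V n → Subspace n → Subspace n → Set
  v ∈Sum X , Y = Σ _ λ a → Σ _ λ b → a ∈S X × b ∈S Y × v ≡ a ⊕ b

  IsSum : ∀ {n} → Subspace n → Subspace n → Subspace n → Set
  IsSum X Y Z = ∀ v → (v ∈S Z → v ∈Sum X , Y) × (v ∈Sum X , Y → v ∈S Z)

  IsIntersection : ∀ {n} → Subspace n → Subspace n → Subspace n → Set
  IsIntersection X Y Z = ∀ v → (v ∈S Z → v ∈S X × v ∈S Y) × (v ∈S X × v ∈S Y → v ∈S Z)

  record QMatroid (n : ℕ) : Set₁ where
    field
      ρ      : Subspace n → ℕ
      ρ-dim  : ∀ X d → HasDim X d → ρ X ≤ d
      ρ-mono : ∀ X Y → X ⊆S Y → ρ X ≤ ρ Y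
      ρ-submod : ∀ X Y S I → IsSum X Y S → IsIntersection X Y I →
                 ρ S Data.Nat.+ ρ I ≤ ρ X Data.Nat.+ ρ Y

  module _ {n : ℕ} (M : QMatroid n) where
    open QMatroid M

    rank : ℕ
    rank = ρ (fullSpace n)

    Independent : Subspace n → Set
    Independent X = HasDim X (ρ X)

    IsBasis : Subspace n → Set
    IsBasis X = Independent X × (∀ Y → Independent Y → X ⊆S Y → Y ⊆S X)

{-# OPTIONS --safe #-}
-- Grow a linearly independent list L with ρ ⟨L⟩ = |L| and x ∉ ⟨L⟩ one vector at a time; once
-- |L| = rank, ⟨L⟩ is a basis avoiding x. While |L| < rank the list can be extended: otherwise every
-- v outside ⟨x, L⟩ has ρ ⟨v, L⟩ = ρ ⟨L⟩, so by submodularity adjoining all of them keeps the rank at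
-- |L|. But ⟨x, L⟩ has dimension at most rank < n, and the vectors outside a proper subspace span
-- F_q^n, whence rank ≤ |L|.
module Submission where

open import Defs
open import Algebra.Structures using (IsCommutativeRing)
open import Algebra.Bundles using (CommutativeRing)
import Algebra.Properties.Ring as RingProperties
open import Data.Bool using (Bool; T; _∧_)
open import Data.Bool.Properties using (T-∧)
open import Data.Empty using (⊥-elim)
open import Data.Unit using (tt)
open import Data.List as List using (List; []; _∷_; length; _++_; filter; cartesianProductWith; deduplicate)
open import Data.List.Properties using (length-map; length-++; length-zipWith; filter-notAll; ∷-injective)
open import Data.List.Membership.Propositional using (_∈_; find; lose)
open import Data.List.Membership.Propositional.Properties
  using (∈-map⁺; ∈-map⁻; ∈-filter⁺; ∈-filter⁻; ∈-++⁺ˡ; ∈-++⁺ʳ; ∈-deduplicate⁺; ∈-cartesianProductWith⁺; ∈-cartesianProductWith⁻)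
open import Data.List.Relation.Binary.Subset.Propositional using (_⊆_)
open import Data.List.Relation.Unary.All as All using (All; []; _∷_)
open import Data.List.Relation.Unary.Any as Any using (Any; here; there; any?)
open import Data.List.Relation.Unary.Unique.Propositional using (Unique; []; _∷_)
import Data.List.Relation.Unary.Unique.Propositional.Properties as Unique
open import Data.List.Relation.Unary.Unique.DecPropositional.Properties using (deduplicate-!)
open import Data.Nat as ℕ using (ℕ; zero; suc; _≤_; _<_; _^_; z≤n; s≤s)
open import Data.Nat.Properties
  using ( ⊓-idem; ≤-refl; ≤-trans; <⇒≤; n≤0⇒n≡0; <-≤-trans; ≤-pred; ≮⇒≥; <⇒≱; ≤∧≢⇒<; <-irrefl
        ; suc-injective; ^-monoʳ-<; +-mono-≤; +-cancelʳ-≤; module ≤-Reasoning)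
open import Data.Product using (Σ; _×_; _,_; proj₁; proj₂)
open import Data.Vec as Vec using (Vec; []; _∷_)
open import Data.Vec.Properties
  using ( zipWith-assoc; zipWith-comm; zipWith-identityˡ; zipWith-identityʳ; zipWith-inverseʳ
        ; map-replicate; map-cong; map-∘; map-id; ∷-injectiveˡ; ∷-injectiveʳ; ≡-dec)
open import Function using (_∘_; Equivalence)
open import Relation.Binary.Definitions using (DecidableEquality)
open import Relation.Binary.PropositionalEquality
open import Relation.Nullary using (¬_; Dec; yes; no; ¬?)
open import Relation.Nullary.Decidable using (isYes; toWitness; fromWitness; T?; _×-dec_; decidable-stable)

module _ {a} {A : Set a} where

  Unique-⊆⇒length≤ : DecidableEquality A → {xs ys : List A} → Unique xs → xs ⊆ ys → length xs ≤ length ys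
  Unique-⊆⇒length≤ _≟_ {[]} _ _ = z≤n
  Unique-⊆⇒length≤ _≟_ {x ∷ xs} {ys} (x∉xs ∷ xs!) xxs⊆ys =
    ≤-trans (s≤s (Unique-⊆⇒length≤ _≟_ xs! xs⊆ys-x)) (filter-notAll (¬? ∘ (x ≟_)) ys x∈ys)
    where
    x∈ys : Any (λ y → ¬ ¬ x ≡ y) ys
    x∈ys = Any.map (λ { refl x≢x → x≢x refl }) (xxs⊆ys (here refl))
    xs⊆ys-x : xs ⊆ filter (¬? ∘ (x ≟_)) ys
    xs⊆ys-x z∈xs = ∈-filter⁺ (¬? ∘ (x ≟_)) (xxs⊆ys (there z∈xs)) (All.lookup x∉xs z∈xs)

  Unique-map⁺ : ∀ {b} {B : Set b} (f : A → B) {xs : List A} →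
    (∀ {x y} → x ∈ xs → y ∈ xs → f x ≡ f y → x ≡ y) → Unique xs → Unique (List.map f xs)
  Unique-map⁺ f injective [] = []
  Unique-map⁺ f injective (x∉xs ∷ xs!) =
    All.tabulate (λ z∈fxs fx≡z → let (y , y∈xs , z≡fy) = ∈-map⁻ f z∈fxs in
                   All.lookup x∉xs y∈xs (injective (here refl) (there y∈xs) (trans fx≡z z≡fy)))
    ∷ Unique-map⁺ f (λ x∈ y∈ → injective (there x∈) (there y∈)) xs!

  tuples : List A → ℕ → List (List A)
  tuples xs zero    = [] ∷ []
  tuples xs (suc d) = cartesianProductWith _∷_ xs (tuples xs d)

  ∈-tuples⁻ : ∀ {xs} d {ys} → ys ∈ tuples xs d → length ys ≡ d
  ∈-tuples⁻ zero    (here refl) = refl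
  ∈-tuples⁻ {xs} (suc d) ys∈ with ∈-cartesianProductWith⁻ _∷_ xs (tuples xs d) ys∈
  ... | _ , _ , _ , zs∈ , refl = cong suc (∈-tuples⁻ d zs∈)

  ∈-tuples⁺ : ∀ {xs} → (∀ x → x ∈ xs) → ∀ ys → ys ∈ tuples xs (length ys)
  ∈-tuples⁺ complete []       = here refl
  ∈-tuples⁺ complete (y ∷ ys) = ∈-cartesianProductWith⁺ _∷_ (complete y) (∈-tuples⁺ complete ys)

  length-tuples : ∀ xs d → length (tuples xs d) ≡ length xs ^ d
  length-tuples xs zero    = refl
  length-tuples xs (suc d) = trans (length-cartesianProductWith xs (tuples xs d)) (cong (length xs ℕ.*_) (length-tuples xs d))
    where
    length-cartesianProductWith : ∀ xs (yss : List (List A)) →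
      length (cartesianProductWith _∷_ xs yss) ≡ length xs ℕ.* length yss
    length-cartesianProductWith []       yss = refl
    length-cartesianProductWith (x ∷ xs) yss =
      trans (length-++ (List.map (x ∷_) yss)) (cong₂ ℕ._+_ (length-map (x ∷_) yss) (length-cartesianProductWith xs yss))

  Unique-tuples : ∀ {xs} → Unique xs → ∀ d → Unique (tuples xs d)
  Unique-tuples xs! zero    = [] ∷ []
  Unique-tuples xs! (suc d) = Unique.cartesianProductWith⁺ _∷_ ∷-injective xs! (Unique-tuples xs! d)

  vectors : List A → (m : ℕ) → List (Vec A m)
  vectors xs zero    = [] ∷ []
  vectors xs (suc m) = cartesianProductWith _∷_ xs (vectors xs m)

  ∈-vectors : ∀ {xs m} → (∀ x → x ∈ xs) → (v : Vec A m) → v ∈ vectors xs m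
  ∈-vectors complete []      = here refl
  ∈-vectors complete (x ∷ v) = ∈-cartesianProductWith⁺ _∷_ (complete x) (∈-vectors complete v)

^-cancelˡ-≤ : ∀ m → 1 < m → ∀ {d e} → m ^ d ≤ m ^ e → d ≤ e
^-cancelˡ-≤ m 1<m m^d≤m^e = ≮⇒≥ (λ e<d → <⇒≱ (^-monoʳ-< m 1<m e<d) m^d≤m^e)

module LinearAlgebra (K : FiniteField) where
  open FiniteField K

  private
    module R = IsCommutativeRing isCommutativeRing
    commutativeRing : CommutativeRing _ _
    commutativeRing = record { isCommutativeRing = isCommutativeRing }
    module RP = RingProperties (CommutativeRing.ring commutativeRing)

  infixl 6 _⊞_
  infixr 7 _⊡_
  infix 4 _∈ₛ_ _∈ₛ?_ _⊆ₛ_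

  _⊞_ : ∀ {m} → V K m → V K m → V K m
  _⊞_ = _⊕_ K

  _⊡_ : ∀ {m} → F → V K m → V K m
  _⊡_ = _·_ K

  𝟎 : ∀ {m} → V K m
  𝟎 = zeroV K

  _∈ₛ_ : ∀ {m} → V K m → Subspace K m → Set
  _∈ₛ_ = _∈S_ K

  _⊆ₛ_ : ∀ {m} → Subspace K m → Subspace K m → Set
  _⊆ₛ_ = _⊆S_ K

  _∈ₛ?_ : ∀ {m} (v : V K m) X → Dec (v ∈ₛ X)
  v ∈ₛ? X = T? (mem X v)

  LC : ∀ {m} → List F → List (V K m) → V K m
  LC = lincomb K

  -1# : F
  -1# = - 1#

  ⊞-assoc : ∀ {m} (u v w : V K m) → (u ⊞ v) ⊞ w ≡ u ⊞ (v ⊞ w)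
  ⊞-assoc = zipWith-assoc R.+-assoc

  ⊞-comm : ∀ {m} (u v : V K m) → u ⊞ v ≡ v ⊞ u
  ⊞-comm = zipWith-comm R.+-comm

  ⊞-identityˡ : ∀ {m} (u : V K m) → 𝟎 ⊞ u ≡ u
  ⊞-identityˡ = zipWith-identityˡ R.+-identityˡ

  ⊞-identityʳ : ∀ {m} (u : V K m) → u ⊞ 𝟎 ≡ u
  ⊞-identityʳ = zipWith-identityʳ R.+-identityʳ

  ⊞-inverseʳ : ∀ {m} (u : V K m) → u ⊞ -1# ⊡ u ≡ 𝟎
  ⊞-inverseʳ u = trans (cong (u ⊞_) (map-cong RP.-1*x≈-x u)) (zipWith-inverseʳ R.-‿inverseʳ u)

  ⊡-distribˡ-⊞ : ∀ {m} c (u v : V K m) → c ⊡ (u ⊞ v) ≡ c ⊡ u ⊞ c ⊡ v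
  ⊡-distribˡ-⊞ c []      []      = refl
  ⊡-distribˡ-⊞ c (a ∷ u) (b ∷ v) = cong₂ _∷_ (R.distribˡ c a b) (⊡-distribˡ-⊞ c u v)

  ⊡-distribʳ-+ : ∀ {m} c d (u : V K m) → (c + d) ⊡ u ≡ c ⊡ u ⊞ d ⊡ u
  ⊡-distribʳ-+ c d []      = refl
  ⊡-distribʳ-+ c d (a ∷ u) = cong₂ _∷_ (R.distribʳ a c d) (⊡-distribʳ-+ c d u)

  ⊡-zeroˡ : ∀ {m} (u : V K m) → 0# ⊡ u ≡ 𝟎
  ⊡-zeroˡ []      = refl
  ⊡-zeroˡ (a ∷ u) = cong₂ _∷_ (R.zeroˡ a) (⊡-zeroˡ u)

  ⊡-zeroˡ-⊞ : ∀ {m} (v w : V K m) → 0# ⊡ v ⊞ w ≡ w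
  ⊡-zeroˡ-⊞ v w = trans (cong (_⊞ w) (⊡-zeroˡ v)) (⊞-identityˡ w)

  ⊡-zeroʳ : ∀ {m} c → c ⊡ 𝟎 {m} ≡ 𝟎
  ⊡-zeroʳ c = trans (map-replicate (c *_) 0# _) (cong (Vec.replicate _) (R.zeroʳ c))

  ⊡-assoc : ∀ {m} c d (u : V K m) → (c * d) ⊡ u ≡ c ⊡ (d ⊡ u)
  ⊡-assoc c d u = trans (map-cong (R.*-assoc c d) u) (map-∘ (c *_) (d *_) u)

  ⊡-identityˡ : ∀ {m} (u : V K m) → 1# ⊡ u ≡ u
  ⊡-identityˡ u = trans (map-cong R.*-identityˡ u) (map-id u)

  ⊡-inverse : ∀ {m} {c c⁻¹} → c * c⁻¹ ≡ 1# → (u : V K m) → c⁻¹ ⊡ (c ⊡ u) ≡ u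
  ⊡-inverse {c = c} {c⁻¹} cc⁻¹≡1 u = begin
    c⁻¹ ⊡ (c ⊡ u) ≡⟨ ⊡-assoc c⁻¹ c u ⟨
    (c⁻¹ * c) ⊡ u ≡⟨ cong (_⊡ u) (trans (R.*-comm c⁻¹ c) cc⁻¹≡1) ⟩
    1# ⊡ u        ≡⟨ ⊡-identityˡ u ⟩
    u             ∎
    where open ≡-Reasoning

  ⊞-⊟-cancelʳ : ∀ {m} (u v : V K m) → (u ⊞ v) ⊞ -1# ⊡ v ≡ u
  ⊞-⊟-cancelʳ u v = begin
    (u ⊞ v) ⊞ -1# ⊡ v ≡⟨ ⊞-assoc u v _ ⟩
    u ⊞ (v ⊞ -1# ⊡ v) ≡⟨ cong (u ⊞_) (⊞-inverseʳ v) ⟩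
    u ⊞ 𝟎             ≡⟨ ⊞-identityʳ u ⟩
    u                 ∎
    where open ≡-Reasoning

  ⊞-interchange : ∀ {m} (u v w z : V K m) → (u ⊞ v) ⊞ (w ⊞ z) ≡ (u ⊞ w) ⊞ (v ⊞ z)
  ⊞-interchange u v w z = begin
    (u ⊞ v) ⊞ (w ⊞ z) ≡⟨ ⊞-assoc u v _ ⟩
    u ⊞ (v ⊞ (w ⊞ z)) ≡⟨ cong (u ⊞_) (⊞-assoc v w z) ⟨
    u ⊞ ((v ⊞ w) ⊞ z) ≡⟨ cong (λ t → u ⊞ (t ⊞ z)) (⊞-comm v w) ⟩
    u ⊞ ((w ⊞ v) ⊞ z) ≡⟨ cong (u ⊞_) (⊞-assoc w v z) ⟩
    u ⊞ (w ⊞ (v ⊞ z)) ≡⟨ ⊞-assoc u w _ ⟨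
    (u ⊞ w) ⊞ (v ⊞ z) ∎
    where open ≡-Reasoning

  LinIndep-[] : ∀ {m} → LinIndep K {m} []
  LinIndep-[] []      _  _ = []
  LinIndep-[] (_ ∷ _) () _

  LC-[]ʳ : ∀ {m} cs → LC {m} cs [] ≡ 𝟎
  LC-[]ʳ []       = refl
  LC-[]ʳ (c ∷ cs) = refl

  LC-scale : ∀ {m} c cs (vs : List (V K m)) → LC (List.map (c *_) cs) vs ≡ c ⊡ LC cs vs
  LC-scale c []       vs       = sym (⊡-zeroʳ c)
  LC-scale c (a ∷ cs) []       = sym (⊡-zeroʳ c)
  LC-scale c (a ∷ cs) (v ∷ vs) = begin
    (c * a) ⊡ v ⊞ LC (List.map (c *_) cs) vs ≡⟨ cong₂ _⊞_ (⊡-assoc c a v) (LC-scale c cs vs) ⟩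
    c ⊡ (a ⊡ v) ⊞ c ⊡ LC cs vs               ≡⟨ ⊡-distribˡ-⊞ c _ _ ⟨
    c ⊡ (a ⊡ v ⊞ LC cs vs)                   ∎
    where open ≡-Reasoning

  LC-+ : ∀ {m} cs ds (vs : List (V K m)) → length cs ≡ length ds →
         LC (List.zipWith _+_ cs ds) vs ≡ LC cs vs ⊞ LC ds vs
  LC-+ []       []       vs       _ = sym (⊞-identityˡ 𝟎)
  LC-+ (a ∷ cs) (b ∷ ds) []       _ = sym (⊞-identityˡ 𝟎)
  LC-+ (a ∷ cs) (b ∷ ds) (v ∷ vs) |cs|≡|ds| = begin
    (a + b) ⊡ v ⊞ LC (List.zipWith _+_ cs ds) vs
      ≡⟨ cong₂ _⊞_ (⊡-distribʳ-+ a b v) (LC-+ cs ds vs (suc-injective |cs|≡|ds|)) ⟩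
    (a ⊡ v ⊞ b ⊡ v) ⊞ (LC cs vs ⊞ LC ds vs)
      ≡⟨ ⊞-interchange _ _ _ _ ⟩
    (a ⊡ v ⊞ LC cs vs) ⊞ (b ⊡ v ⊞ LC ds vs) ∎
    where open ≡-Reasoning

  ≡-if-differences-vanish : ∀ cs ds → length cs ≡ length ds →
    All (_≡ 0#) (List.zipWith _+_ cs (List.map (-1# *_) ds)) → cs ≡ ds
  ≡-if-differences-vanish []       []       _ _ = refl
  ≡-if-differences-vanish (c ∷ cs) (d ∷ ds) |cs|≡|ds| (c-d≡0 ∷ cs-ds≡0) = cong₂ _∷_
    (RP.x∙y⁻¹≈ε⇒x≈y c d (trans (cong (c +_) (sym (RP.-1*x≈-x d))) c-d≡0))
    (≡-if-differences-vanish cs ds (suc-injective |cs|≡|ds|) cs-ds≡0)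

  LC-injective : ∀ {m} {vs : List (V K m)} → LinIndep K vs → ∀ {cs ds} →
    length cs ≡ length vs → length ds ≡ length vs → LC cs vs ≡ LC ds vs → cs ≡ ds
  LC-injective {vs = vs} vs-indep {cs} {ds} |cs| |ds| cs≡ds =
    ≡-if-differences-vanish cs ds |cs|≡|ds| (vs-indep (List.zipWith _+_ cs ds⁻) |cs-ds| (begin
      LC (List.zipWith _+_ cs ds⁻) vs ≡⟨ LC-+ cs ds⁻ vs (trans |cs|≡|ds| (sym (length-map _ ds))) ⟩
      LC cs vs ⊞ LC ds⁻ vs           ≡⟨ cong₂ _⊞_ cs≡ds (LC-scale -1# ds vs) ⟩
      LC ds vs ⊞ -1# ⊡ LC ds vs      ≡⟨ ⊞-inverseʳ _ ⟩
      𝟎                              ∎))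
    where
    open ≡-Reasoning
    ds⁻ : List F
    ds⁻ = List.map (-1# *_) ds
    |cs|≡|ds| : length cs ≡ length ds
    |cs|≡|ds| = trans |cs| (sym |ds|)
    |cs-ds| : length (List.zipWith _+_ cs ds⁻) ≡ length vs
    |cs-ds| = begin
      length (List.zipWith _+_ cs ds⁻) ≡⟨ length-zipWith _+_ cs ds⁻ ⟩
      length cs ℕ.⊓ length ds⁻        ≡⟨ cong (length cs ℕ.⊓_) (trans (length-map _ ds) (sym |cs|≡|ds|)) ⟩
      length cs ℕ.⊓ length cs         ≡⟨ ⊓-idem (length cs) ⟩
      length cs                       ≡⟨ |cs| ⟩
      length vs                       ∎

  resize : ℕ → List F → List F
  resize zero    _        = []
  resize (suc d) []       = 0# ∷ resize d []
  resize (suc d) (c ∷ cs) = c ∷ resize d cs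

  length-resize : ∀ d cs → length (resize d cs) ≡ d
  length-resize zero    _        = refl
  length-resize (suc d) []       = cong suc (length-resize d [])
  length-resize (suc d) (c ∷ cs) = cong suc (length-resize d cs)

  LC-resize : ∀ {m} cs (vs : List (V K m)) → LC (resize (length vs) cs) vs ≡ LC cs vs
  LC-resize cs       []       = sym (LC-[]ʳ cs)
  LC-resize []       (v ∷ vs) = trans (cong₂ _⊞_ (⊡-zeroˡ v) (LC-resize [] vs)) (⊞-identityˡ 𝟎)
  LC-resize (c ∷ cs) (v ∷ vs) = cong (c ⊡ v ⊞_) (LC-resize cs vs)

  scalars : List F
  scalars = deduplicate _≟_ elements

  ∈-scalars : ∀ a → a ∈ scalars
  ∈-scalars a = ∈-deduplicate⁺ _≟_ (complete a)

  1<|scalars| : 1 < length scalars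
  1<|scalars| = Unique-⊆⇒length≤ _≟_ ((0≢1 ∷ []) ∷ [] ∷ []) (λ {a} _ → ∈-scalars a)

  coefficients : ℕ → List (List F)
  coefficients = tuples scalars

  InSpan : ∀ {m} → List (V K m) → V K m → Set
  InSpan vs v = Σ (List F) λ cs → LC cs vs ≡ v

  -- Only coefficient lists of length |vs| need to be searched, and there are finitely many.
  inSpan? : ∀ {m} (vs : List (V K m)) v → Dec (Any (λ cs → LC cs vs ≡ v) (coefficients (length vs)))
  inSpan? vs v = any? (λ cs → ≡-dec _≟_ (LC cs vs) v) (coefficients (length vs))

  inSpanᵇ : ∀ {m} → List (V K m) → V K m → Bool
  inSpanᵇ vs v = isYes (inSpan? vs v)

  inSpanᵇ⁺ : ∀ {m} (vs : List (V K m)) {v} → InSpan vs v → T (inSpanᵇ vs v)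
  inSpanᵇ⁺ vs {v} (cs , cs·vs≡v) = fromWitness (lose resized∈ (trans (LC-resize cs vs) cs·vs≡v))
    where
    resized∈ : resize (length vs) cs ∈ coefficients (length vs)
    resized∈ = subst (λ d → resize (length vs) cs ∈ coefficients d) (length-resize (length vs) cs)
                 (∈-tuples⁺ ∈-scalars (resize (length vs) cs))

  inSpanᵇ⁻ : ∀ {m} (vs : List (V K m)) {v} → T (inSpanᵇ vs v) →
    Σ (List F) λ cs → length cs ≡ length vs × LC cs vs ≡ v
  inSpanᵇ⁻ vs t with cs , cs∈ , cs·vs≡v ← find (toWitness t) = cs , ∈-tuples⁻ (length vs) cs∈ , cs·vs≡v

  span : ∀ {m} → List (V K m) → Subspace K m
  span vs = record
    { mem      = inSpanᵇ vs
    ; zero∈    = inSpanᵇ⁺ vs ([] , refl)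
    ; ⊕-closed = λ u v u∈ v∈ →
        let (cs , |cs| , cs·vs≡u) = inSpanᵇ⁻ vs u∈
            (ds , |ds| , ds·vs≡v) = inSpanᵇ⁻ vs v∈
        in inSpanᵇ⁺ vs (List.zipWith _+_ cs ds ,
             trans (LC-+ cs ds vs (trans |cs| (sym |ds|))) (cong₂ _⊞_ cs·vs≡u ds·vs≡v))
    ; ·-closed = λ c v v∈ →
        let (cs , _ , cs·vs≡v) = inSpanᵇ⁻ vs v∈
        in inSpanᵇ⁺ vs (List.map (c *_) cs , trans (LC-scale c cs vs) (cong (c ⊡_) cs·vs≡v))
    }

  LC-∈ₛ : ∀ {m} (X : Subspace K m) cs {vs} → All (_∈ₛ X) vs → LC cs vs ∈ₛ X
  LC-∈ₛ X []       _              = zero∈ X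
  LC-∈ₛ X (c ∷ cs) []             = zero∈ X
  LC-∈ₛ X (c ∷ cs) (v∈X ∷ vs⊆X) = ⊕-closed X _ _ (·-closed X c _ v∈X) (LC-∈ₛ X cs vs⊆X)

  span-minimal : ∀ {m} (X : Subspace K m) {vs} → All (_∈ₛ X) vs → span vs ⊆ₛ X
  span-minimal X {vs} vs⊆X v v∈ with cs , _ , refl ← inSpanᵇ⁻ vs v∈ = LC-∈ₛ X cs vs⊆X

  ∈⇒InSpan : ∀ {m} {v : V K m} {vs} → v ∈ vs → InSpan vs v
  ∈⇒InSpan {v = v} (here refl) = 1# ∷ [] , trans (⊞-identityʳ _) (⊡-identityˡ v)
  ∈⇒InSpan {vs = w ∷ vs} (there v∈vs) with cs , cs·vs≡v ← ∈⇒InSpan v∈vs =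
    0# ∷ cs , trans (cong (_⊞ LC cs vs) (⊡-zeroˡ w)) (trans (⊞-identityˡ _) cs·vs≡v)

  ∈⇒∈span : ∀ {m} {v : V K m} {vs} → v ∈ vs → v ∈ₛ span vs
  ∈⇒∈span {vs = vs} v∈vs = inSpanᵇ⁺ vs (∈⇒InSpan v∈vs)

  span-⊇ : ∀ {m} (vs : List (V K m)) → All (_∈ₛ span vs) vs
  span-⊇ vs = All.tabulate ∈⇒∈span

  span-mono : ∀ {m} {vs ws : List (V K m)} → vs ⊆ ws → span vs ⊆ₛ span ws
  span-mono {ws = ws} vs⊆ws = span-minimal (span ws) (All.tabulate (∈⇒∈span ∘ vs⊆ws))

  combinations : ∀ {m} → List (V K m) → List (V K m)
  combinations vs = List.map (λ cs → LC cs vs) (coefficients (length vs))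

  length-combinations : ∀ {m} (vs : List (V K m)) → length (combinations vs) ≡ length scalars ^ length vs
  length-combinations vs = trans (length-map _ (coefficients (length vs))) (length-tuples scalars (length vs))

  Unique-combinations : ∀ {m} {vs : List (V K m)} → LinIndep K vs → Unique (combinations vs)
  Unique-combinations {vs = vs} vs-indep = Unique-map⁺ (λ cs → LC cs vs)
    (λ cs∈ ds∈ → LC-injective vs-indep (∈-tuples⁻ (length vs) cs∈) (∈-tuples⁻ (length vs) ds∈))
    (Unique-tuples (deduplicate-! _≟_ elements) (length vs))

  ∈span⇒∈combinations : ∀ {m} {ws : List (V K m)} {v} → v ∈ₛ span ws → v ∈ combinations ws
  ∈span⇒∈combinations {ws = ws} v∈ with ds , |ds| , refl ← inSpanᵇ⁻ ws v∈ =
    ∈-map⁺ (λ cs → LC cs ws) (subst (λ d → ds ∈ coefficients d) |ds| (∈-tuples⁺ ∈-scalars ds))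

  -- The q ^ |vs| combinations of vs are distinct and lie among the q ^ |ws| combinations of ws.
  LinIndep⇒length≤ : ∀ {m} {vs ws : List (V K m)} → LinIndep K vs → All (InSpan ws) vs → length vs ≤ length ws
  LinIndep⇒length≤ {vs = vs} {ws} vs-indep vs⊆⟨ws⟩ = ^-cancelˡ-≤ (length scalars) 1<|scalars| (begin
    length scalars ^ length vs ≡⟨ length-combinations vs ⟨
    length (combinations vs)   ≤⟨ Unique-⊆⇒length≤ (≡-dec _≟_) (Unique-combinations vs-indep) combinations-⊆ ⟩
    length (combinations ws)   ≡⟨ length-combinations ws ⟩
    length scalars ^ length ws ∎)
    where
    open ≤-Reasoning
    combinations-⊆ : combinations vs ⊆ combinations ws
    combinations-⊆ z∈ with cs , _ , refl ← ∈-map⁻ (λ cs → LC cs vs) z∈ =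
      ∈span⇒∈combinations (LC-∈ₛ (span ws) cs (All.map (inSpanᵇ⁺ ws) vs⊆⟨ws⟩))

  ⊡⊞∈ₛ⇒∈ₛ : ∀ {m} (X : Subspace K m) {c v w} → ¬ c ≡ 0# → w ∈ₛ X → c ⊡ v ⊞ w ∈ₛ X → v ∈ₛ X
  ⊡⊞∈ₛ⇒∈ₛ X {c} {v} {w} c≢0 w∈X cv+w∈X with c⁻¹ , cc⁻¹≡1 ← inv c c≢0 =
    subst (_∈ₛ X) (⊡-inverse cc⁻¹≡1 v) (·-closed X c⁻¹ _ cv∈X)
    where
    cv∈X : c ⊡ v ∈ₛ X
    cv∈X = subst (_∈ₛ X) (⊞-⊟-cancelʳ (c ⊡ v) w) (⊕-closed X _ _ cv+w∈X (·-closed X -1# w w∈X))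

  LinIndep-∷ : ∀ {m} {vs : List (V K m)} {v} → LinIndep K vs → ¬ v ∈ₛ span vs → LinIndep K (v ∷ vs)
  LinIndep-∷ vs-indep v∉ [] () _
  LinIndep-∷ {vs = vs} {v} vs-indep v∉ (c ∷ cs) |c∷cs| cv+cs·vs≡𝟎 with c ≟ 0#
  ... | yes refl = refl ∷ vs-indep cs (suc-injective |c∷cs|) (trans (sym (⊡-zeroˡ-⊞ v _)) cv+cs·vs≡𝟎)
  ... | no c≢0   = ⊥-elim (v∉ (⊡⊞∈ₛ⇒∈ₛ (span vs) c≢0 (inSpanᵇ⁺ vs (cs , refl))
                     (subst (_∈ₛ span vs) (sym cv+cs·vs≡𝟎) (zero∈ (span vs)))))

  span-exchange : ∀ {m} {vs : List (V K m)} {x v} → ¬ x ∈ₛ span vs → x ∈ₛ span (v ∷ vs) → v ∈ₛ span (x ∷ vs)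
  span-exchange {vs = vs} {x} {v} x∉ x∈ with inSpanᵇ⁻ (v ∷ vs) x∈
  ... | [] , () , _
  ... | c ∷ cs , _ , cv+cs·vs≡x with c ≟ 0#
  ...   | yes refl = ⊥-elim (x∉ (inSpanᵇ⁺ vs (cs , trans (sym (⊡-zeroˡ-⊞ v _)) cv+cs·vs≡x)))
  ...   | no c≢0   = ⊡⊞∈ₛ⇒∈ₛ (span (x ∷ vs)) c≢0 (LC-∈ₛ (span (x ∷ vs)) cs (All.tail (span-⊇ (x ∷ vs))))
                       (subst (_∈ₛ span (x ∷ vs)) (sym cv+cs·vs≡x) (∈⇒∈span (here refl)))

  standardBasis : (m : ℕ) → List (V K m)
  standardBasis zero    = []
  standardBasis (suc m) = (1# ∷ 𝟎) ∷ List.map (0# ∷_) (standardBasis m)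

  length-standardBasis : ∀ m → length (standardBasis m) ≡ m
  length-standardBasis zero    = refl
  length-standardBasis (suc m) = cong suc (trans (length-map _ (standardBasis m)) (length-standardBasis m))

  LC-map-0∷ : ∀ {m} cs (vs : List (V K m)) → LC cs (List.map (0# ∷_) vs) ≡ 0# ∷ LC cs vs
  LC-map-0∷ []       vs       = refl
  LC-map-0∷ (c ∷ cs) []       = refl
  LC-map-0∷ (c ∷ cs) (v ∷ vs) =
    trans (cong ((c * 0# ∷ c ⊡ v) ⊞_) (LC-map-0∷ cs vs))
          (cong (_∷ (c ⊡ v ⊞ LC cs vs)) (trans (R.+-identityʳ _) (R.zeroʳ c)))

  LinIndep-standardBasis : ∀ m → LinIndep K (standardBasis m)
  LinIndep-standardBasis zero    []       _ _ = []
  LinIndep-standardBasis (suc m) (c ∷ cs) |c∷cs| c∷cs·e≡𝟎 = c≡0 ∷ LinIndep-standardBasis m cs |cs| cs·e≡𝟎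
    where
    e : List (V K m)
    e = standardBasis m
    componentwise : ((c * 1#) + 0#) ∷ (c ⊡ 𝟎 ⊞ LC cs e) ≡ 0# ∷ 𝟎
    componentwise = trans (cong ((c * 1# ∷ c ⊡ 𝟎) ⊞_) (sym (LC-map-0∷ cs e))) c∷cs·e≡𝟎
    c≡0 : c ≡ 0#
    c≡0 = trans (sym (trans (R.+-identityʳ _) (R.*-identityʳ c))) (∷-injectiveˡ componentwise)
    |cs| : length cs ≡ length e
    |cs| = trans (suc-injective |c∷cs|) (length-map _ e)
    cs·e≡𝟎 : LC cs e ≡ 𝟎
    cs·e≡𝟎 = trans (sym (trans (cong (_⊞ LC cs e) (⊡-zeroʳ c)) (⊞-identityˡ _))) (∷-injectiveʳ componentwise)

  spanning⇒length≥dim : ∀ {m} (ws : List (V K m)) → (∀ v → v ∈ₛ span ws) → m ≤ length ws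
  spanning⇒length≥dim {m} ws spanning = subst (_≤ length ws) (length-standardBasis m)
    (LinIndep⇒length≤ (LinIndep-standardBasis m)
      (All.tabulate λ {e} _ → let (cs , _ , cs·ws≡e) = inSpanᵇ⁻ ws (spanning e) in cs , cs·ws≡e))

  _∩_ : ∀ {m} → Subspace K m → Subspace K m → Subspace K m
  X ∩ Y = record
    { mem      = λ v → mem X v ∧ mem Y v
    ; zero∈    = both (zero∈ X) (zero∈ Y)
    ; ⊕-closed = λ u v u∈ v∈ → both (⊕-closed X u v (inX u∈) (inX v∈)) (⊕-closed Y u v (inY u∈) (inY v∈))
    ; ·-closed = λ c v v∈ → both (·-closed X c v (inX v∈)) (·-closed Y c v (inY v∈))
    }
    where
    both : ∀ {v} → v ∈ₛ X → v ∈ₛ Y → T (mem X v ∧ mem Y v)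
    both v∈X v∈Y = Equivalence.from T-∧ (v∈X , v∈Y)
    inX : ∀ {v} → T (mem X v ∧ mem Y v) → v ∈ₛ X
    inX = proj₁ ∘ Equivalence.to T-∧
    inY : ∀ {v} → T (mem X v ∧ mem Y v) → v ∈ₛ Y
    inY = proj₂ ∘ Equivalence.to T-∧

  ∩-isIntersection : ∀ {m} (X Y : Subspace K m) → IsIntersection K X Y (X ∩ Y)
  ∩-isIntersection X Y v = Equivalence.to T-∧ , Equivalence.from T-∧

  LC-++ : ∀ {m} cs (as bs : List (V K m)) →
    LC cs (as ++ bs) ≡ LC (List.take (length as) cs) as ⊞ LC (List.drop (length as) cs) bs
  LC-++ cs       []       bs = sym (⊞-identityˡ _)
  LC-++ []       (a ∷ as) bs = sym (⊞-identityˡ 𝟎)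
  LC-++ (c ∷ cs) (a ∷ as) bs = trans (cong (c ⊡ a ⊞_) (LC-++ cs as bs)) (sym (⊞-assoc _ _ _))

  span-++-isSum : ∀ {m} (as bs : List (V K m)) → IsSum K (span as) (span bs) (span (as ++ bs))
  span-++-isSum as bs v = split , join
    where
    split : v ∈ₛ span (as ++ bs) → _∈Sum_,_ K v (span as) (span bs)
    split v∈ with cs , _ , cs·as++bs≡v ← inSpanᵇ⁻ (as ++ bs) v∈ =
      _ , _ , inSpanᵇ⁺ as (List.take (length as) cs , refl) , inSpanᵇ⁺ bs (List.drop (length as) cs , refl) ,
      trans (sym cs·as++bs≡v) (LC-++ cs as bs)
    join : _∈Sum_,_ K v (span as) (span bs) → v ∈ₛ span (as ++ bs)
    join (a , b , a∈ , b∈ , refl) =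
      ⊕-closed (span (as ++ bs)) a b (span-mono ∈-++⁺ˡ a a∈) (span-mono (∈-++⁺ʳ as) b b∈)

  complement⊆⇒full : ∀ {m} (X Y : Subspace K m) {u} → ¬ u ∈ₛ X →
    (∀ v → ¬ v ∈ₛ X → v ∈ₛ Y) → ∀ t → t ∈ₛ Y
  complement⊆⇒full X Y {u} u∉X Xᶜ⊆Y t with t ∈ₛ? X
  ... | no t∉X  = Xᶜ⊆Y t t∉X
  ... | yes t∈X = subst (_∈ₛ Y) (⊞-⊟-cancelʳ t u)
                    (⊕-closed Y _ _ (Xᶜ⊆Y (t ⊞ u) t+u∉X) (·-closed Y -1# u (Xᶜ⊆Y u u∉X)))
    where
    t+u∉X : ¬ t ⊞ u ∈ₛ X
    t+u∉X t+u∈X = u∉X (subst (_∈ₛ X) (trans (cong (_⊞ -1# ⊡ t) (⊞-comm t u)) (⊞-⊟-cancelʳ u t))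
                         (⊕-closed X _ _ t+u∈X (·-closed X -1# t t∈X)))

module QMatroidProperties (K : FiniteField) {n : ℕ} (M : QMatroid K n) where
  open LinearAlgebra K
  open QMatroid M

  ρ≤rank : ∀ X → ρ X ≤ rank K M
  ρ≤rank X = ρ-mono X (fullSpace K n) (λ _ _ → tt)

  HasDim-span : ∀ {vs : List (V K n)} → LinIndep K vs → HasDim K (span vs) (length vs)
  HasDim-span {vs} vs-indep =
    vs , (span-⊇ vs , vs-indep , λ v v∈ → let (cs , _ , cs·vs≡v) = inSpanᵇ⁻ vs v∈ in cs , cs·vs≡v) , refl

  ρ-span≤length : ∀ {vs : List (V K n)} → LinIndep K vs → ρ (span vs) ≤ length vs
  ρ-span≤length vs-indep = ρ-dim _ _ (HasDim-span vs-indep)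

  span-isBasis : ∀ {vs : List (V K n)} → LinIndep K vs → ρ (span vs) ≡ length vs → length vs ≡ rank K M →
    IsBasis K M (span vs)
  span-isBasis {vs} vs-indep ρ≡|vs| |vs|≡rank = subst (HasDim K (span vs)) (sym ρ≡|vs|) (HasDim-span vs-indep) , maximal
    where
    maximal : ∀ Y → Independent K M Y → span vs ⊆ₛ Y → Y ⊆ₛ span vs
    maximal Y (ws , (_ , _ , ws-spans) , |ws|≡ρY) vs⊆Y v v∈Y with v ∈ₛ? span vs
    ... | yes v∈ = v∈
    ... | no v∉  = ⊥-elim (<-irrefl refl (begin-strict
      length vs       <⟨ LinIndep⇒length≤ (LinIndep-∷ vs-indep v∉) v∷vs⊆⟨ws⟩ ⟩
      length ws       ≡⟨ |ws|≡ρY ⟩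
      ρ Y             ≤⟨ ρ≤rank Y ⟩
      rank K M        ≡⟨ |vs|≡rank ⟨
      length vs       ∎))
      where
      open ≤-Reasoning
      v∷vs⊆⟨ws⟩ : All (InSpan ws) (v ∷ vs)
      v∷vs⊆⟨ws⟩ = ws-spans v v∈Y ∷ All.map (λ {w} w∈ → ws-spans w (vs⊆Y w w∈)) (span-⊇ vs)

  ρ-span-++-≤ : ∀ L ws → All (λ w → ρ (span (w ∷ L)) ≤ ρ (span L)) ws → ρ (span (ws ++ L)) ≤ ρ (span L)
  ρ-span-++-≤ L []       _              = ≤-refl
  ρ-span-++-≤ L (w ∷ ws) (ρw≤ρL ∷ ρws≤ρL) = ≤-trans (ρ-mono _ Z (span-mono reorder)) ρZ≤ρL
    where
    open ≤-Reasoning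
    X Y Z : Subspace K n
    X = span (ws ++ L)
    Y = span (w ∷ L)
    Z = span ((ws ++ L) ++ (w ∷ L))
    ρL≤ρX∩Y : ρ (span L) ≤ ρ (X ∩ Y)
    ρL≤ρX∩Y = ρ-mono (span L) (X ∩ Y) (span-minimal (X ∩ Y)
      (All.tabulate λ v∈L → proj₂ (∩-isIntersection X Y _)
        (∈⇒∈span (∈-++⁺ʳ ws v∈L) , ∈⇒∈span (there v∈L))))
    ρZ≤ρL : ρ Z ≤ ρ (span L)
    ρZ≤ρL = +-cancelʳ-≤ (ρ (span L)) (ρ Z) (ρ (span L)) (begin
      ρ Z ℕ.+ ρ (span L)          ≤⟨ +-mono-≤ (≤-refl {ρ Z}) ρL≤ρX∩Y ⟩
      ρ Z ℕ.+ ρ (X ∩ Y)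
        ≤⟨ ρ-submod X Y Z (X ∩ Y) (span-++-isSum (ws ++ L) (w ∷ L)) (∩-isIntersection X Y) ⟩
      ρ X ℕ.+ ρ Y                 ≤⟨ +-mono-≤ (ρ-span-++-≤ L ws ρws≤ρL) ρw≤ρL ⟩
      ρ (span L) ℕ.+ ρ (span L)   ∎)
    reorder : w ∷ ws ++ L ⊆ (ws ++ L) ++ (w ∷ L)
    reorder (here refl) = ∈-++⁺ʳ (ws ++ L) (here refl)
    reorder (there v∈)  = ∈-++⁺ˡ v∈

  module AvoidingVector (x : V K n) where

    record Avoiding (L : List (V K n)) : Set where
      field
        independent : LinIndep K L
        ρ-span      : ρ (span L) ≡ length L
        x∉span      : ¬ x ∈ₛ span L
    open Avoiding public

    Avoiding-[] : ¬ x ≡ 𝟎 → Avoiding []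
    Avoiding-[] x≢𝟎 = record
      { independent = LinIndep-[]
      ; ρ-span      = n≤0⇒n≡0 (ρ-span≤length LinIndep-[])
      ; x∉span      = λ x∈ → let (cs , _ , cs·[]≡x) = inSpanᵇ⁻ [] x∈ in x≢𝟎 (trans (sym cs·[]≡x) (LC-[]ʳ cs))
      }

    Extends : List (V K n) → V K n → Set
    Extends L v = ¬ v ∈ₛ span (x ∷ L) × ρ (span (v ∷ L)) ≡ suc (length L)

    extends? : ∀ L v → Dec (Extends L v)
    extends? L v = ¬? (v ∈ₛ? span (x ∷ L)) ×-dec (ρ (span (v ∷ L)) ℕ.≟ suc (length L))

    outside? : ∀ L v → Dec (¬ v ∈ₛ span (x ∷ L))
    outside? L v = ¬? (v ∈ₛ? span (x ∷ L))

    Avoiding-∷ : ∀ {L v} → Avoiding L → Extends L v → Avoiding (v ∷ L)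
    Avoiding-∷ {v = v} avoids (v∉ , ρ≡) = record
      { independent = LinIndep-∷ (independent avoids) (v∉ ∘ span-mono there v)
      ; ρ-span      = ρ≡
      ; x∉span      = v∉ ∘ span-exchange (x∉span avoids)
      }

    ρ-span-∷≤-if-not-extending : ∀ {L w} → Avoiding L → ¬ w ∈ₛ span (x ∷ L) → ¬ Extends L w →
      ρ (span (w ∷ L)) ≤ ρ (span L)
    ρ-span-∷≤-if-not-extending {L} {w} avoids w∉ not-extending = begin
      ρ (span (w ∷ L)) ≤⟨ ≤-pred (≤∧≢⇒< (ρ-span≤length w∷L-indep) (λ ρ≡ → not-extending (w∉ , ρ≡))) ⟩
      length L         ≡⟨ ρ-span avoids ⟨
      ρ (span L)       ∎
      where
      open ≤-Reasoning
      w∷L-indep : LinIndep K (w ∷ L)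
      w∷L-indep = LinIndep-∷ (independent avoids) (w∉ ∘ span-mono there w)

    rank≤length-if-stuck : ∀ {L} → rank K M < n → Avoiding L → (∀ v → ¬ Extends L v) → rank K M ≤ length L
    rank≤length-if-stuck {L} rank<n avoids stuck with any? (outside? L) (vectors scalars n)
    ... | no ∄outside = ≤-pred (<-≤-trans rank<n (spanning⇒length≥dim (x ∷ L) λ t →
                          decidable-stable (t ∈ₛ? span (x ∷ L)) (∄outside ∘ lose (∈-vectors ∈-scalars t))))
    ... | yes ∃outside with u , _ , u∉ ← find ∃outside = begin
      rank K M          ≤⟨ ρ-mono (fullSpace K n) (span (W ++ L)) (λ t _ → spanned t) ⟩
      ρ (span (W ++ L)) ≤⟨ ρ-span-++-≤ L W (All.tabulate rank-stays) ⟩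
      ρ (span L)        ≡⟨ ρ-span avoids ⟩
      length L          ∎
      where
      open ≤-Reasoning
      W : List (V K n)
      W = filter (outside? L) (vectors scalars n)
      spanned : ∀ t → t ∈ₛ span (W ++ L)
      spanned = complement⊆⇒full (span (x ∷ L)) (span (W ++ L)) u∉
        (λ v v∉ → ∈⇒∈span (∈-++⁺ˡ (∈-filter⁺ (outside? L) (∈-vectors ∈-scalars v) v∉)))
      rank-stays : ∀ {w} → w ∈ W → ρ (span (w ∷ L)) ≤ ρ (span L)
      rank-stays w∈W = ρ-span-∷≤-if-not-extending avoids
        (proj₂ (∈-filter⁻ (outside? L) {xs = vectors scalars n} w∈W)) (stuck _)

    Avoiding-extend : ∀ {L} → rank K M < n → Avoiding L → length L < rank K M → Σ (V K n) λ v → Avoiding (v ∷ L)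
    Avoiding-extend {L} rank<n avoids |L|<rank with any? (extends? L) (vectors scalars n)
    ... | yes ∃extension with v , _ , extends ← find ∃extension = v , Avoiding-∷ avoids extends
    ... | no ∄extension = ⊥-elim (<⇒≱ |L|<rank (rank≤length-if-stuck rank<n avoids
                            (λ v extends → ∄extension (lose (∈-vectors ∈-scalars v) extends))))

    Avoiding-of-length : rank K M < n → ¬ x ≡ 𝟎 → ∀ d → d ≤ rank K M →
      Σ (List (V K n)) λ L → Avoiding L × length L ≡ d
    Avoiding-of-length rank<n x≢𝟎 zero    _      = [] , Avoiding-[] x≢𝟎 , refl
    Avoiding-of-length rank<n x≢𝟎 (suc d) d<rank
      with L , avoids , refl ← Avoiding-of-length rank<n x≢𝟎 d (<⇒≤ d<rank)
      with v , avoids′ ← Avoiding-extend rank<n avoids d<rank = v ∷ L , avoids′ , refl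

lemma5p4 : (K : FiniteField) (n : ℕ) (M : QMatroid K n) →
    0 < rank K M → rank K M < n →
    ¬ (Σ (V K n) λ x → ¬ (x ≡ zeroV K) × (∀ B → IsBasis K M B → _∈S_ K x B))
lemma5p4 K n M _ rank<n (x , x≢𝟎 , x∈every-basis) =
  let (L , avoids , |L|≡rank) = Avoiding-of-length rank<n x≢𝟎 (rank K M) ≤-refl
  in x∉span avoids (x∈every-basis (span L) (span-isBasis (independent avoids) (ρ-span avoids) |L|≡rank))
  where
  open LinearAlgebra K
  open QMatroidProperties K M
  open AvoidingVector x
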